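{- Let $G$ be a connected stepwise irregular graph. Then the four graph indices $$M_1(G)=\sum_{v\in V(G)} d_G(v)^2,\quad M_2(G)=\sum_{uv\in E(G)} d_G(u)d_G(v),\quad \Pi_1(G)=\prod_{v\in V(G)} d_G(v)^2,\quad \Pi_2(G)=\prod_{uv\in E(G)} d_G(u)d_G(v)$$ are all even integers.
   Context: All graphs are finite and simple. $d_G(v)$ denotes the degree of vertex $v$ in $G$. A graph $G$ is stepwise irregular (SI) if for every edge $uv\in E(G)$ one has $|d_G(u)-d_G(v)|=1$. -}

module Defs where

open import Data.Nat using (ℕ; zero; suc; _+_; _*_; _<_; _≤_)
open import Data.Nat.Divisibility using (_∣_)
open import Data.Bool using (Bool; true; false; if_then_else_)
open import Data.Fin using (Fin; toℕ)
open import Data.Fin.Properties using (_<?_)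
open import Data.List using (List; []; _∷_; length; filter; map; concatMap; allFin)
open import Data.Nat.ListAction using (sum; product)
open import Data.Product using (_×_; _,_; proj₁; proj₂)
open import Data.Integer using (ℤ; ∣_∣; +_; _-_)
open import Relation.Binary.PropositionalEquality using (_≡_)
open import Relation.Nullary.Decidable using (does)

record Graph (n : ℕ) : Set where
  field
    adj    : Fin n → Fin n → Bool
    sym    : ∀ u v → adj u v ≡ adj v u
    irrefl : ∀ v → adj v v ≡ false
open Graph public

deg : ∀ {n} → Graph n → Fin n → ℕ
deg {n} G v = length (filter (λ w → adj G v w Data.Bool.≟ true) (allFin n))

-- E(G): each edge uv listed once, as the pair (u , v) with u < v
edges : ∀ {n} → Graph n → List (Fin n × Fin n)
edges {n} G =
  concatMap (λ u → map (λ v → (u , v))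
                        (filter (λ v → u <? v) (filter (λ v → adj G u v Data.Bool.≟ true) (allFin n))))
            (allFin n)

data Reach {n} (G : Graph n) : Fin n → Fin n → Set where
  here : ∀ {v} → Reach G v v
  step : ∀ {u w v} → adj G u w ≡ true → Reach G w v → Reach G u v

Connected : ∀ {n} → Graph n → Set
Connected {n} G = ∀ (u v : Fin n) → Reach G u v

StepwiseIrregular : ∀ {n} → Graph n → Set
StepwiseIrregular {n} G =
  ∀ (u v : Fin n) → adj G u v ≡ true →
    ∣ (+ deg G u) - (+ deg G v) ∣ ≡ 1

M₁ : ∀ {n} → Graph n → ℕ
M₁ {n} G = sum (map (λ v → deg G v * deg G v) (allFin n))

M₂ : ∀ {n} → Graph n → ℕ
M₂ G = sum (map (λ e → deg G (proj₁ e) * deg G (proj₂ e)) (edges G))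

Π₁ : ∀ {n} → Graph n → ℕ
Π₁ {n} G = product (map (λ v → deg G v * deg G v) (allFin n))

Π₂ : ∀ {n} → Graph n → ℕ
Π₂ G = product (map (λ e → deg G (proj₁ e) * deg G (proj₂ e)) (edges G))

Even : ℕ → Set
Even m = 2 ∣ m

module Submission where

-- Along an edge uv of a stepwise irregular graph the degrees d(u), d(v)
-- are consecutive integers, so one of them is even and d(u)d(v) is even.
--   * M₂ is a sum of such edge products, hence even.
--   * Π₂ is a product of edge products; a connected graph on ≥ 2 vertices has
--     at least one edge, so one factor of Π₂ is even.
--   * Π₁ has the factor d(x)² for an endpoint x of that edge with d(x) even.
--   * M₁ needs no stepwise irregularity: d² + d = d(d+1) is even, so
--     M₁ ≡ Σ d(v) (mod 2), and Σ d(v) is even by the handshake lemma, which we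
--     derive from the fact that a symmetric ℕ-matrix with zero diagonal has an
--     even total sum.

open import Defs
open import Data.Nat using (ℕ; zero; suc; _+_; _*_; _≤_; z≤n; s≤s)
open import Data.Nat.Properties using (+-assoc; *-comm; *-suc; +-identityʳ; +-0-commutativeMonoid)
open import Data.Nat.Divisibility
  using (_∣_; divides; _∣0; ∣-trans; ∣m∣n⇒∣m+n; ∣m+n∣m⇒∣n; ∣m⇒∣m*n; ∣n⇒∣m*n)
open import Data.Nat.ListAction using (sum; product)
open import Data.Nat.ListAction.Properties using (∈⇒∣product)
open import Data.Integer using (_⊖_; _-_) renaming (∣_∣ to ∣_∣ℤ; +_ to pos)
open import Data.Integer.Properties using (m-n≡m⊖n; [1+m]⊖[1+n]≡m⊖n)
open import Data.Bool using (Bool; true; false; _≟_)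
open import Data.Fin using (Fin; _<_) renaming (zero to fzero; suc to fsuc)
open import Data.Fin.Properties using (_<?_)
open import Data.List using (List; []; _∷_; length; filter; map; concatMap; allFin; tabulate)
open import Data.List.Properties using (map-tabulate)
open import Data.List.Membership.Propositional using (_∈_)
open import Data.List.Membership.Propositional.Properties
  using (∈-map⁺; ∈-map⁻; ∈-filter⁺; ∈-filter⁻; ∈-concatMap⁺; ∈-concatMap⁻; ∈-allFin)
open import Data.List.Relation.Unary.Any as Any using (here; there)
open import Data.Product using (_×_; _,_; proj₁; proj₂; ∃₂)
open import Data.Sum using (_⊎_; inj₁; inj₂)
open import Function using (_∘_)
open import Relation.Binary.PropositionalEquality
  using (_≡_; refl; cong; cong₂; subst; trans; module ≡-Reasoning)
  renaming (sym to ≡-sym)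
open import Algebra.Properties.CommutativeMonoid.Sum +-0-commutativeMonoid
  using (∑-distrib-+; sum-cong-≗) renaming (sum to ∑)

even-or-odd : ∀ k → 2 ∣ k ⊎ 2 ∣ suc k
even-or-odd zero    = inj₁ (2 ∣0)
even-or-odd (suc k) with even-or-odd k
... | inj₁ 2∣k   = inj₂ (∣m∣n⇒∣m+n (divides 1 refl) 2∣k)
... | inj₂ 2∣1+k = inj₁ 2∣1+k

plus-square-even : ∀ d → 2 ∣ d + d * d
plus-square-even d = subst (2 ∣_) (*-suc d d) consecutive-product
  where
  consecutive-product : 2 ∣ d * suc d
  consecutive-product with even-or-odd d
  ... | inj₁ 2∣d   = ∣m⇒∣m*n (suc d) 2∣d
  ... | inj₂ 2∣1+d = ∣n⇒∣m*n d 2∣1+d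

double-even : ∀ r → 2 ∣ r + r
double-even r = divides r (trans (cong (r +_) (≡-sym (+-identityʳ r))) (*-comm 2 r))

distance-one-consecutive : ∀ m n → ∣ m ⊖ n ∣ℤ ≡ 1 → m ≡ suc n ⊎ n ≡ suc m
distance-one-consecutive zero          (suc zero)    _ = inj₂ refl
distance-one-consecutive (suc zero)    zero          _ = inj₁ refl
distance-one-consecutive (suc m)       (suc n)       d rewrite [1+m]⊖[1+n]≡m⊖n m n
  with distance-one-consecutive m n d
... | inj₁ m≡1+n = inj₁ (cong suc m≡1+n)
... | inj₂ n≡1+m = inj₂ (cong suc n≡1+m)
distance-one-consecutive zero          zero          ()
distance-one-consecutive zero          (suc (suc n)) ()
distance-one-consecutive (suc (suc m)) zero          ()

distance-one-even : ∀ a b → ∣ pos a - pos b ∣ℤ ≡ 1 → 2 ∣ a ⊎ 2 ∣ b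
distance-one-even a b d with distance-one-consecutive a b (subst (λ z → ∣ z ∣ℤ ≡ 1) (m-n≡m⊖n a b) d)
distance-one-even .(suc b) b _ | inj₁ refl with even-or-odd b
... | inj₁ 2∣b   = inj₂ 2∣b
... | inj₂ 2∣1+b = inj₁ 2∣1+b
distance-one-even a .(suc a) _ | inj₂ refl with even-or-odd a
... | inj₁ 2∣a   = inj₁ 2∣a
... | inj₂ 2∣1+a = inj₂ 2∣1+a

distance-one-product-even : ∀ a b → ∣ pos a - pos b ∣ℤ ≡ 1 → 2 ∣ a * b
distance-one-product-even a b d with distance-one-even a b d
... | inj₁ 2∣a = ∣m⇒∣m*n b 2∣a
... | inj₂ 2∣b = ∣n⇒∣m*n a 2∣b

sum-allFin : ∀ n (f : Fin n → ℕ) → sum (map f (allFin n)) ≡ ∑ f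
sum-allFin n f = trans (cong sum (map-tabulate (λ i → i) f)) (sum-tabulate n f)
  where
  sum-tabulate : ∀ n (h : Fin n → ℕ) → sum (tabulate h) ≡ ∑ h
  sum-tabulate zero    h = refl
  sum-tabulate (suc n) h = cong (h fzero +_) (sum-tabulate n (h ∘ fsuc))

∣-sum-map : ∀ {A : Set} {d} (g : A → ℕ) (xs : List A) → (∀ x → x ∈ xs → d ∣ g x) →
  d ∣ sum (map g xs)
∣-sum-map g []       _     = _ ∣0
∣-sum-map g (x ∷ xs) d∣g = ∣m∣n⇒∣m+n (d∣g x (here refl)) (∣-sum-map g xs (λ y → d∣g y ∘ there))

∣-product-map : ∀ {A : Set} {d x} (g : A → ℕ) {xs : List A} → x ∈ xs → d ∣ g x →
  d ∣ product (map g xs)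
∣-product-map g x∈xs d∣gx = ∣-trans d∣gx (∈⇒∣product (∈-map⁺ g x∈xs))

-- Peeling off row and column 0 contributes R + R, where R is the
-- sum of row 0 (= the sum of column 0 by symmetry).
symmetric-sum-even : ∀ {n} (f : Fin n → Fin n → ℕ) →
  (∀ u v → f u v ≡ f v u) → (∀ v → f v v ≡ 0) → 2 ∣ ∑ (λ u → ∑ (f u))
symmetric-sum-even {zero}  f _   _    = 2 ∣0
symmetric-sum-even {suc n} f symmetric diag =
  subst (2 ∣_) (≡-sym peel) (∣m∣n⇒∣m+n (double-even R) rest-even)
  where
  R : ℕ
  R = ∑ (f fzero ∘ fsuc)
  T : ℕ
  T = ∑ (λ u → ∑ (f (fsuc u) ∘ fsuc))
  rest-even : 2 ∣ T
  rest-even = symmetric-sum-even (λ u v → f (fsuc u) (fsuc v))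
    (λ u v → symmetric (fsuc u) (fsuc v)) (diag ∘ fsuc)
  peel : ∑ (λ u → ∑ (f u)) ≡ (R + R) + T
  peel = begin
      (f fzero fzero + R) + ∑ (λ u → f (fsuc u) fzero + ∑ (f (fsuc u) ∘ fsuc))
    ≡⟨ cong₂ _+_ (cong (_+ R) (diag fzero)) (∑-distrib-+ (λ u → f (fsuc u) fzero) _) ⟩
      R + (∑ (λ u → f (fsuc u) fzero) + T)
    ≡⟨ cong (λ c → R + (c + T)) (sum-cong-≗ (λ u → symmetric (fsuc u) fzero)) ⟩
      R + (R + T)
    ≡⟨ ≡-sym (+-assoc R R T) ⟩
      (R + R) + T
    ∎
    where open ≡-Reasoning

indicator : Bool → ℕ
indicator true  = 1
indicator false = 0

length-filter-true : ∀ {A : Set} (p : A → Bool) (xs : List A) →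
  length (filter (λ x → p x ≟ true) xs) ≡ sum (map (indicator ∘ p) xs)
length-filter-true p []       = refl
length-filter-true p (x ∷ xs) with p x
... | true  = cong suc (length-filter-true p xs)
... | false = length-filter-true p xs

deg-as-sum : ∀ {n} (G : Graph n) v → deg G v ≡ ∑ (λ w → indicator (adj G v w))
deg-as-sum {n} G v = trans (length-filter-true (adj G v) (allFin n)) (sum-allFin n _)

degree-sum-even : ∀ {n} (G : Graph n) → 2 ∣ ∑ (deg G)
degree-sum-even G =
  subst (2 ∣_) (sum-cong-≗ (λ v → ≡-sym (deg-as-sum G v)))
    (symmetric-sum-even (λ u v → indicator (adj G u v))
      (λ u v → cong indicator (sym G u v)) (λ v → cong indicator (irrefl G v)))

partners : ∀ {n} (G : Graph n) (u : Fin n) → List (Fin n)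
partners {n} G u = filter (u <?_) (filter (λ v → adj G u v ≟ true) (allFin n))

edges-adjacent : ∀ {n} (G : Graph n) e → e ∈ edges G → adj G (proj₁ e) (proj₂ e) ≡ true
edges-adjacent {n} G e e∈E
  with Any.satisfied (∈-concatMap⁻ (λ u → map (u ,_) (partners G u)) {xs = allFin n} e∈E)
... | u , e∈u with ∈-map⁻ (u ,_) e∈u
... | v , v∈partners , refl =
  proj₂ (∈-filter⁻ (λ w → adj G u w ≟ true) {xs = allFin n}
    (proj₁ (∈-filter⁻ (u <?_) {xs = filter (λ w → adj G u w ≟ true) (allFin n)} v∈partners)))

adjacent-in-edges : ∀ {n} (G : Graph n) {u v} → u < v → adj G u v ≡ true → (u , v) ∈ edges G
adjacent-in-edges {n} G {u} {v} u<v uv =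
  ∈-concatMap⁺ (λ x → map (x ,_) (partners G x))
    (Any.map (λ { refl → ∈-map⁺ (u ,_) v∈partners }) (∈-allFin {n} u))
  where
  v∈partners : v ∈ partners G u
  v∈partners = ∈-filter⁺ (u <?_) (∈-filter⁺ (λ w → adj G u w ≟ true) (∈-allFin v) uv) u<v

-- A connected graph on at least two vertices has an edge: the walk from
-- vertex 0 to vertex 1 starts with an edge 0w, and w ≠ 0 by irreflexivity.
connected-has-edge : ∀ {n} (G : Graph n) → 2 ≤ n → Connected G →
  ∃₂ λ u v → u < v × adj G u v ≡ true
connected-has-edge G (s≤s (s≤s z≤n)) connected = first-step (connected fzero (fsuc fzero))
  where
  first-step : Reach G fzero (fsuc fzero) → ∃₂ λ u v → u < v × adj G u v ≡ true
  first-step (step {w = fzero} loop _) with trans (≡-sym loop) (irrefl G fzero)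
  ... | ()
  first-step (step {w = fsuc w} 0w _) = fzero , fsuc w , s≤s z≤n , 0w

edge-product-even : ∀ {n} (G : Graph n) → StepwiseIrregular G →
  ∀ u v → adj G u v ≡ true → 2 ∣ deg G u * deg G v
edge-product-even G si u v uv = distance-one-product-even (deg G u) (deg G v) (si u v uv)

M₁-even : ∀ {n} (G : Graph n) → Even (M₁ G)
M₁-even {n} G = subst (2 ∣_) (≡-sym (sum-allFin n _))
  (∣m+n∣m⇒∣n (subst (2 ∣_) (∑-distrib-+ (deg G) _) pointwise-even) (degree-sum-even G))
  where
  pointwise-even : 2 ∣ ∑ (λ v → deg G v + deg G v * deg G v)
  pointwise-even = subst (2 ∣_) (sum-allFin n _)
    (∣-sum-map _ (allFin n) (λ v _ → plus-square-even (deg G v)))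

M₂-even : ∀ {n} (G : Graph n) → StepwiseIrregular G → Even (M₂ G)
M₂-even G si = ∣-sum-map _ (edges G)
  (λ e e∈E → edge-product-even G si (proj₁ e) (proj₂ e) (edges-adjacent G e e∈E))

Π₁-even : ∀ {n} (G : Graph n) → StepwiseIrregular G → ∀ {u v} → adj G u v ≡ true → Even (Π₁ G)
Π₁-even G si {u} {v} uv with distance-one-even (deg G u) (deg G v) (si u v uv)
... | inj₁ 2∣du = ∣-product-map (λ x → deg G x * deg G x) (∈-allFin u) (∣m⇒∣m*n (deg G u) 2∣du)
... | inj₂ 2∣dv = ∣-product-map (λ x → deg G x * deg G x) (∈-allFin v) (∣m⇒∣m*n (deg G v) 2∣dv)

Π₂-even : ∀ {n} (G : Graph n) → StepwiseIrregular G → ∀ {u v} → u < v → adj G u v ≡ true →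
  Even (Π₂ G)
Π₂-even G si {u} {v} u<v uv =
  ∣-product-map (λ e → deg G (proj₁ e) * deg G (proj₂ e))
    (adjacent-in-edges G u<v uv) (edge-product-even G si u v uv)

mainTheorem1 : ∀ (n : ℕ) (G : Graph n) → 2 ≤ n → Connected G → StepwiseIrregular G →
    Even (M₁ G) × Even (M₂ G) × Even (Π₁ G) × Even (Π₂ G)
mainTheorem1 n G 2≤n connected si with connected-has-edge G 2≤n connected
... | u , v , u<v , uv = M₁-even G , M₂-even G si , Π₁-even G si uv , Π₂-even G si u<v uv
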